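{- Let $m\ge 5$, let $3\leq k\leq m-1$ and $r\in\mathbb N_0$. If $k$ is odd, then $$\sum_{i=r}^{r+F_k-1}s(i)=\begin{cases}\varphi^{k-1}+\varphi^{ -1}&\text{if }\pi(r)<F_{m-k},\\ \varphi^{k-1}&\text{otherwise.}\end{cases}$$ If $k$ is even, then $$\sum_{i=r}^{r+F_k-1}s(i)=\begin{cases}\varphi^{k-1}-\varphi^{ -1}&\text{if }\pi(r)\geq F_m-F_{m-k},\\ \varphi^{k-1}&\text{otherwise.}\end{cases}$$
   Context: Fibonacci numbers: $F_1=F_2=1$, $F_k=F_{k-1}+F_{k-2}$; $\varphi=\frac{1+\sqrt5}{2}$. For fixed $m$, $\pi:\mathbb N_0\to\{0,\dots,F_m-1\}$ is $\pi(k)=kF_{m-2}\bmod F_m$ (so $\pi$ is $F_m$-periodic), and $s:\mathbb N_0\to\{1,\varphi\}$ is given by $s(i)=\varphi$ if $\pi(i)<\pi(i+1)$ and $s(i)=1$ otherwise. -}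

module Defs where

open import Data.Nat as ℕ using (ℕ; zero; suc; _∸_; _<ᵇ_)
open import Data.Integer as ℤ using (ℤ; +_; -[1+_])
open import Data.Bool using (if_then_else_)

F : ℕ → ℕ
F zero = zero
F (suc zero) = suc zero
F (suc (suc k)) = F (suc k) ℕ.+ F k

-- The ring ℤ[φ] (φ = (1+√5)/2, φ² = φ + 1).  The record ⟨ a , b ⟩ denotes a + bφ.
-- Since φ is irrational, this representation is unique, so ≡ on records is
-- equality of the real numbers they denote.
record ℤφ : Set where
  constructor ⟨_,_⟩
  field
    re : ℤ
    im : ℤ

infixl 6 _+φ_ _-φ_
infixl 7 _*φ_
infixr 8 _^φ_

_+φ_ : ℤφ → ℤφ → ℤφ
⟨ a , b ⟩ +φ ⟨ c , d ⟩ = ⟨ a ℤ.+ c , b ℤ.+ d ⟩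

_-φ_ : ℤφ → ℤφ → ℤφ
⟨ a , b ⟩ -φ ⟨ c , d ⟩ = ⟨ a ℤ.- c , b ℤ.- d ⟩

-- (a + bφ)(c + dφ) = (ac + bd) + (ad + bc + bd)φ   using φ² = φ + 1
_*φ_ : ℤφ → ℤφ → ℤφ
⟨ a , b ⟩ *φ ⟨ c , d ⟩ = ⟨ a ℤ.* c ℤ.+ b ℤ.* d , a ℤ.* d ℤ.+ b ℤ.* c ℤ.+ b ℤ.* d ⟩

0φ 1φ φ : ℤφ
0φ = ⟨ + 0 , + 0 ⟩
1φ = ⟨ + 1 , + 0 ⟩
φ  = ⟨ + 0 , + 1 ⟩

-- φ⁻¹ = φ - 1  (indeed φ (φ - 1) = φ² - φ = 1)
φ⁻¹ : ℤφ
φ⁻¹ = ⟨ -[1+ 0 ] , + 1 ⟩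

_^φ_ : ℤφ → ℕ → ℤφ
x ^φ zero = 1φ
x ^φ suc n = x *φ (x ^φ n)

-- π(k) = k F_{m-2} mod F_m.  (F m ≥ 1 for m ≥ 1, where suc (F m ∸ 1) = F m;
-- the theorem only uses m ≥ 5.)
π : (m : ℕ) → ℕ → ℕ
π m k = (k ℕ.* F (m ∸ 2)) ℕ.% suc (F m ∸ 1)

s : (m : ℕ) → ℕ → ℤφ
s m i = if π m i <ᵇ π m (suc i) then φ else 1φ

sumS : (m r n : ℕ) → ℤφ
sumS m r zero = 0φ
sumS m r (suc n) = s m r +φ sumS m (suc r) n

module Submission where

-- Write N = F_m and q = F_{m-2}.  The sequence π(i) = i·q mod N is a rotation
-- of the circle ℤ/N by q: each step either adds q without wrapping around
-- (then π rises and s(i) = φ) or wraps once past N (then π falls and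
-- s(i) = 1).  Hence a window of length n starting at r containing w
-- wrap-arounds has sum w + (n - w)φ, and π(r) + n·q = π(r + n) + w·N, so w is
-- the quotient of π(r) + n·q by N.
--
-- For n = F_k, k = j + 2, m = k + t, Vajda's identity
--   F_{j+2} F_{j+t} = F_j F_{j+t+2} + (-1)^j F_t
-- says n·q = F_j·N + F_t for even k and n·q = F_j·N - F_t for odd k.  So w
-- is F_j, except that it drops to F_j - 1 when π(r) < F_t (odd k) and rises
-- to F_j + 1 when π(r) ≥ N - F_t (even k); both follow from computing the
-- quotient of π(r) + n·q by N.
-- Since φ^{k-1} = F_j + F_{j+1}φ, the window with w = F_j sums to φ^{k-1},
-- and one wrap fewer or more adds or removes 1 - φ = -φ⁻¹.

open import Defs
open import Data.Nat
open import Data.Nat.Properties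
open import Data.Nat.DivMod
open import Data.Nat.Divisibility using (n∣m*n)
open import Data.Nat.Tactic.RingSolver using (solve-∀)
open import Data.Product using (_×_; _,_)
open import Data.Bool using (true; false)
import Data.Integer as ℤ
import Data.Integer.Properties as ℤ
open import Relation.Nullary using (¬_; yes; no; contradiction)
open import Relation.Binary.PropositionalEquality
open ≡-Reasoning
open import Algebra.Properties.CommutativeSemigroup +-commutativeSemigroup using (xy∙z≈xz∙y)

F-pos : ∀ {n} → 1 ≤ n → 1 ≤ F n
F-pos {suc zero} _ = ≤-refl
F-pos {suc (suc n)} _ = ≤-trans (F-pos {suc n} (s≤s z≤n)) (m≤m+n (F (suc n)) (F n))

F-mono : ∀ d n → F n ≤ F (d + n)
F-mono zero n = ≤-refl
F-mono (suc d) n = ≤-trans (F-mono d n) (F-step (d + n))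
  where
  F-step : ∀ i → F i ≤ F (suc i)
  F-step zero = z≤n
  F-step (suc i) = m≤m+n (F (suc i)) (F i)

φ-power : ∀ n → φ ^φ suc n ≡ ⟨ ℤ.+ F n , ℤ.+ F (suc n) ⟩
φ-power zero = refl
φ-power (suc n) = begin
  φ *φ (φ ^φ suc n)                         ≡⟨ cong (φ *φ_) (φ-power n) ⟩
  φ *φ ⟨ ℤ.+ F n , ℤ.+ F (suc n) ⟩          ≡⟨ cong₂ ⟨_,_⟩ (φ-re (ℤ.+ F n) (ℤ.+ F (suc n))) (φ-im (ℤ.+ F n) (ℤ.+ F (suc n))) ⟩
  ⟨ ℤ.+ F (suc n) , ℤ.+ (F n + F (suc n)) ⟩ ≡⟨ cong (λ x → ⟨ ℤ.+ F (suc n) , ℤ.+ x ⟩) (+-comm (F n) (F (suc n))) ⟩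
  ⟨ ℤ.+ F (suc n) , ℤ.+ F (suc (suc n)) ⟩   ∎
  where
  -- multiplication by φ sends a + bφ to b + (a + b)φ
  φ-re : ∀ a b → ℤ.0ℤ ℤ.* a ℤ.+ ℤ.1ℤ ℤ.* b ≡ b
  φ-re a b = trans (cong₂ ℤ._+_ (ℤ.*-zeroˡ a) (ℤ.*-identityˡ b)) (ℤ.+-identityˡ b)
  φ-im : ∀ a b → ℤ.0ℤ ℤ.* b ℤ.+ ℤ.1ℤ ℤ.* a ℤ.+ ℤ.1ℤ ℤ.* b ≡ a ℤ.+ b
  φ-im a b = cong₂ ℤ._+_ (trans (cong₂ ℤ._+_ (ℤ.*-zeroˡ b) (ℤ.*-identityˡ a)) (ℤ.+-identityˡ a)) (ℤ.*-identityˡ b)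

suc[n∸1]≡n : ∀ {n} → 1 ≤ n → suc (n ∸ 1) ≡ n
suc[n∸1]≡n (s≤s _) = refl

even-pred : ∀ n → suc n % 2 ≡ 0 → n % 2 ≡ 1
even-pred zero ()
even-pred (suc zero) _ = refl
even-pred (suc (suc n)) h = even-pred n h

odd-pred : ∀ n → suc n % 2 ≡ 1 → n % 2 ≡ 0
odd-pred zero _ = refl
odd-pred (suc zero) ()
odd-pred (suc (suc n)) h = odd-pred n h

-- Vajda's identity F_{j+2} F_{j+t} - F_j F_{j+t+2} = (-1)^j F_t, split by the
-- parity of j so that both sides stay in ℕ.
VajdaEven VajdaOdd : ℕ → ℕ → Set
VajdaEven j t = F (2 + j) * F (j + t) ≡ F j * F (2 + j + t) + F t
VajdaOdd j t = F (2 + j) * F (j + t) + F t ≡ F j * F (2 + j + t)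

-- The difference F_{j+2} F_{j+t} - F_j F_{j+t+2} changes sign when j grows by one.
vajda-shift : ∀ j t → F (3 + j) * F (1 + j + t) + F (2 + j) * F (j + t)
                    ≡ F (1 + j) * F (3 + j + t) + F j * F (2 + j + t)
vajda-shift j t = identity (F j) (F (suc j)) (F (j + t)) (F (suc (j + t)))
  where
  identity : ∀ x y u v → (y + x + y) * v + (y + x) * u ≡ y * (v + u + v) + x * (v + u)
  identity = solve-∀

vajda-even : ∀ j t → j % 2 ≡ 0 → VajdaEven j t
vajda-odd : ∀ j t → j % 2 ≡ 1 → VajdaOdd j t

vajda-even zero t _ = +-identityʳ (F t)
vajda-even (suc j) t h = +-cancelʳ-≡ (F j * F (2 + j + t)) _ _ (begin
  X + W           ≡⟨ cong (X +_) (sym (vajda-odd j t (even-pred j h))) ⟩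
  X + (Y + F t)   ≡⟨ sym (+-assoc X Y (F t)) ⟩
  X + Y + F t     ≡⟨ cong (_+ F t) (vajda-shift j t) ⟩
  Z + W + F t     ≡⟨ xy∙z≈xz∙y Z W (F t) ⟩
  Z + F t + W     ∎)
  where
  X = F (3 + j) * F (1 + j + t)
  Y = F (2 + j) * F (j + t)
  Z = F (1 + j) * F (3 + j + t)
  W = F j * F (2 + j + t)

vajda-odd zero t ()
vajda-odd (suc j) t h = +-cancelʳ-≡ (F j * F (2 + j + t)) _ _ (begin
  X + F t + W     ≡⟨ +-assoc X (F t) W ⟩
  X + (F t + W)   ≡⟨ cong (X +_) (trans (+-comm (F t) W) (sym (vajda-even j t (odd-pred j h)))) ⟩
  X + Y           ≡⟨ vajda-shift j t ⟩
  Z + W           ∎)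
  where
  X = F (3 + j) * F (1 + j + t)
  Y = F (2 + j) * F (j + t)
  Z = F (1 + j) * F (3 + j + t)
  W = F j * F (2 + j + t)

module _ {N : ℕ} .{{_ : NonZero N}} where

  /-+-multiple : ∀ c J → (c + J * N) / N ≡ c / N + J
  /-+-multiple c J = trans (+-distrib-/-∣ʳ c (n∣m*n J)) (cong (c / N +_) (m*n/n≡m J N))

  quotient-shift : ∀ {b c J w} → b < N → c + J * N ≡ b + w * N → w ≡ c / N + J
  quotient-shift {b} {c} {J} {w} b<N eq = begin
    w                ≡⟨ cong (_+ w) (m<n⇒m/n≡0 b<N) ⟨
    b / N + w        ≡⟨ /-+-multiple b w ⟨
    (b + w * N) / N  ≡⟨ cong (_/ N) eq ⟨
    (c + J * N) / N  ≡⟨ /-+-multiple c J ⟩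
    c / N + J        ∎

  /-one : ∀ {c} → N ≤ c → c < N + N → c / N ≡ 1
  /-one {c} N≤c c<2N = trans (m/n≡1+[m∸n]/n N≤c) (cong suc (m<n⇒m/n≡0 c∸N<N))
    where
    c∸N<N : c ∸ N < N
    c∸N<N = subst (c ∸ N <_) (m+n∸m≡n N N) (∸-monoˡ-< c<2N N≤c)

  %-wrap : ∀ {x y} → x < N → y < N → N ≤ x + y → (x + y) % N + N ≡ x + y
  %-wrap {x} {y} x<N y<N N≤x+y = begin
    (x + y) % N + N       ≡⟨ cong (_+ N) (m≤n⇒[n∸m]%m≡n%m N≤x+y) ⟨
    (x + y ∸ N) % N + N   ≡⟨ cong (_+ N) (m<n⇒m%n≡m x+y∸N<N) ⟩
    x + y ∸ N + N         ≡⟨ m∸n+n≡m N≤x+y ⟩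
    x + y                 ∎
    where
    x+y∸N<N : x + y ∸ N < N
    x+y∸N<N = subst (x + y ∸ N <_) (m+n∸m≡n N N) (∸-monoˡ-< (+-mono-< x<N y<N) N≤x+y)

windowSum : ℕ → ℕ → ℤφ
windowSum n w = ⟨ ℤ.+ w , ℤ.+ (n ∸ w) ⟩

s-rising : ∀ m i → π m i < π m (suc i) → s m i ≡ φ
s-rising m i rise with π m i <ᵇ π m (suc i) | <⇒<ᵇ rise
... | true | _ = refl

s-falling : ∀ m i → π m (suc i) ≤ π m i → s m i ≡ 1φ
s-falling m i fall with π m i <ᵇ π m (suc i) | <ᵇ⇒< (π m i) (π m (suc i))
... | false | _ = refl
... | true | rises = contradiction (rises _) (≤⇒≯ fall)

module Rotation (m : ℕ) (q>0 : 0 < F (m ∸ 2)) (q<N : F (m ∸ 2) < suc (F m ∸ 1)) where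

  N q : ℕ
  N = suc (F m ∸ 1)
  q = F (m ∸ 2)

  π<N : ∀ i → π m i < N
  π<N i = m%n<n (i * q) N

  π-step : ∀ i → π m (suc i) ≡ (π m i + q) % N
  π-step i = begin
    (q + i * q) % N             ≡⟨ %-distribˡ-+ q (i * q) N ⟩
    (q % N + π m i) % N         ≡⟨ cong (λ x → (x + π m i) % N) (m<n⇒m%n≡m q<N) ⟩
    (q + π m i) % N             ≡⟨ cong (_% N) (+-comm q (π m i)) ⟩
    (π m i + q) % N             ∎

  data Step (i : ℕ) : Set where
    advance : π m (suc i) ≡ π m i + q → s m i ≡ φ → Step i
    wrap : π m (suc i) + N ≡ π m i + q → s m i ≡ 1φ → Step i

  step : ∀ i → Step i
  step i with π m i + q <? N
  ... | yes no-wrap = advance advances (s-rising m i (subst (π m i <_) (sym advances) (m<m+n (π m i) q>0)))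
    where
    advances : π m (suc i) ≡ π m i + q
    advances = trans (π-step i) (m<n⇒m%n≡m no-wrap)
  ... | no crosses = wrap wraps (s-falling m i (<⇒≤ falls))
    where
    wraps : π m (suc i) + N ≡ π m i + q
    wraps = trans (cong (_+ N) (π-step i)) (%-wrap (π<N i) q<N (≮⇒≥ crosses))
    falls : π m (suc i) < π m i
    falls = +-cancelʳ-< N _ _ (subst (_< π m i + N) (sym wraps) (+-monoʳ-< (π m i) q<N))

  record Winding (r n : ℕ) : Set where
    field
      wraps : ℕ
      wraps≤n : wraps ≤ n
      sum≡ : sumS m r n ≡ windowSum n wraps
      displacement : π m r + n * q ≡ π m (r + n) + wraps * N

  winding : ∀ r n → Winding r n
  winding r zero = record
    { wraps = 0 ; wraps≤n = z≤n ; sum≡ = refl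
    ; displacement = cong (λ x → π m x + 0) (sym (+-identityʳ r)) }
  winding r (suc n) with winding (suc r) n | step r
  ... | record { wraps = w ; wraps≤n = w≤n ; sum≡ = sum ; displacement = disp } | advance adv sφ = record
    { wraps = w
    ; wraps≤n = m≤n⇒m≤1+n w≤n
    ; sum≡ = trans (cong₂ _+φ_ sφ sum) (cong (λ x → ⟨ ℤ.+ w , ℤ.+ x ⟩) (sym (+-∸-assoc 1 w≤n)))
    ; displacement = begin
        π m r + (q + n * q)          ≡⟨ +-assoc (π m r) q (n * q) ⟨
        π m r + q + n * q            ≡⟨ cong (_+ n * q) adv ⟨
        π m (suc r) + n * q          ≡⟨ disp ⟩
        π m (suc r + n) + w * N      ≡⟨ cong (λ x → π m x + w * N) (+-suc r n) ⟨
        π m (r + suc n) + w * N      ∎ }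
  ... | record { wraps = w ; wraps≤n = w≤n ; sum≡ = sum ; displacement = disp } | wrap wr s1 = record
    { wraps = suc w
    ; wraps≤n = s≤s w≤n
    ; sum≡ = cong₂ _+φ_ s1 sum
    ; displacement = begin
        π m r + (q + n * q)              ≡⟨ +-assoc (π m r) q (n * q) ⟨
        π m r + q + n * q                ≡⟨ cong (_+ n * q) wr ⟨
        π m (suc r) + N + n * q          ≡⟨ xy∙z≈xz∙y (π m (suc r)) N (n * q) ⟩
        π m (suc r) + n * q + N          ≡⟨ cong (_+ N) disp ⟩
        π m (suc r + n) + w * N + N      ≡⟨ cong (λ x → π m x + w * N + N) (+-suc r n) ⟨
        π m (r + suc n) + w * N + N      ≡⟨ +-assoc (π m (r + suc n)) (w * N) N ⟩
        π m (r + suc n) + (w * N + N)    ≡⟨ cong (π m (r + suc n) +_) (+-comm (w * N) N) ⟩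
        π m (r + suc n) + suc w * N      ∎ }

window-exact : ∀ a b → windowSum (a + b) b ≡ ⟨ ℤ.+ b , ℤ.+ a ⟩
window-exact a b = cong (λ x → ⟨ ℤ.+ b , ℤ.+ x ⟩) (m+n∸n≡m a b)

window-fewer : ∀ a b → 1 ≤ b → windowSum (a + b) (b ∸ 1) ≡ ⟨ ℤ.+ b , ℤ.+ a ⟩ +φ φ⁻¹
window-fewer a (suc b) _ = cong₂ ⟨_,_⟩
  (sym (trans (ℤ.m-n≡m⊖n (suc b) 1) (ℤ.⊖-≥ (s≤s z≤n))))
  (cong ℤ.+_ (trans (cong (_∸ b) (sym (+-assoc a 1 b))) (m+n∸n≡m (a + 1) b)))

window-more : ∀ a b → 1 ≤ a → windowSum (a + b) (suc b) ≡ ⟨ ℤ.+ b , ℤ.+ a ⟩ -φ φ⁻¹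
window-more (suc a) b _ = cong₂ ⟨_,_⟩
  (cong ℤ.+_ (+-comm 1 b))
  (trans (cong ℤ.+_ (trans (cong (_∸ suc b) (sym (+-suc a b))) (m+n∸n≡m a (suc b))))
         (sym (trans (ℤ.m-n≡m⊖n (suc a) 1) (ℤ.⊖-≥ (s≤s z≤n)))))

module Window (j t r : ℕ) (1≤j : 1 ≤ j) where

  m N q T a : ℕ
  m = 2 + j + t
  N = suc (F m ∸ 1)
  q = F (j + t)
  T = F t
  a = π m r

  N≡Fm : N ≡ F m
  N≡Fm = suc[n∸1]≡n (F-pos {m} (s≤s z≤n))

  q<N : q < N
  q<N = subst (q <_) (sym N≡Fm) (+-monoˡ-< q (F-pos {1 + j + t} (s≤s z≤n)))

  T≤q : T ≤ q
  T≤q = F-mono j t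

  T<N : T < N
  T<N = ≤-<-trans T≤q q<N

  open Rotation m (F-pos (≤-trans 1≤j (m≤m+n j t))) q<N using (π<N; winding; Winding)
  open Winding (winding r (F (2 + j)))

  sum-by-carry : ∀ c J → c + J * N ≡ a + F (2 + j) * q
               → sumS m r (F (2 + j)) ≡ windowSum (F (1 + j) + F j) (c / N + J)
  sum-by-carry c J eq = trans sum≡ (cong (windowSum (F (2 + j)))
    (quotient-shift {c = c} {J = J} (π<N (r + F (2 + j))) (trans eq displacement)))

  -- k odd: π(r) + F_k q = (π(r) + N - F_t) + (F_j - 1) N, carry 0 or 1.
  odd-window : j % 2 ≡ 1 →
      (a < T → sumS m r (F (2 + j)) ≡ φ ^φ suc j +φ φ⁻¹)
    × (T ≤ a → sumS m r (F (2 + j)) ≡ φ ^φ suc j)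
  odd-window odd = below , above
    where
    -- the remainder-side term; it lies in [0, N) iff π(r) < F_t
    c : ℕ
    c = a + N ∸ T
    T≤a+N : T ≤ a + N
    T≤a+N = ≤-trans (<⇒≤ T<N) (m≤n+m N a)
    regroup : c + (F j ∸ 1) * N ≡ a + F (2 + j) * q
    regroup = +-cancelʳ-≡ T _ _ (begin
      c + (F j ∸ 1) * N + T        ≡⟨ xy∙z≈xz∙y c ((F j ∸ 1) * N) T ⟩
      (c + T) + (F j ∸ 1) * N      ≡⟨ cong (_+ (F j ∸ 1) * N) (m∸n+n≡m T≤a+N) ⟩
      a + N + (F j ∸ 1) * N        ≡⟨ +-assoc a N _ ⟩
      a + suc (F j ∸ 1) * N        ≡⟨ cong (λ x → a + x * N) (suc[n∸1]≡n (F-pos 1≤j)) ⟩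
      a + F j * N                  ≡⟨ cong (λ x → a + F j * x) N≡Fm ⟩
      a + F j * F m                ≡⟨ cong (a +_) (vajda-odd j t odd) ⟨
      a + (F (2 + j) * q + T)      ≡⟨ +-assoc a _ T ⟨
      a + F (2 + j) * q + T        ∎)
    below : a < T → sumS m r (F (2 + j)) ≡ φ ^φ suc j +φ φ⁻¹
    below a<T = begin
      sumS m r (F (2 + j))                                 ≡⟨ sum-by-carry c (F j ∸ 1) regroup ⟩
      windowSum (F (1 + j) + F j) (c / N + (F j ∸ 1))      ≡⟨ cong (λ x → windowSum (F (1 + j) + F j) (x + (F j ∸ 1))) (m<n⇒m/n≡0 c<N) ⟩
      windowSum (F (1 + j) + F j) (F j ∸ 1)                ≡⟨ window-fewer (F (1 + j)) (F j) (F-pos 1≤j) ⟩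
      ⟨ ℤ.+ F j , ℤ.+ F (1 + j) ⟩ +φ φ⁻¹                   ≡⟨ cong (_+φ φ⁻¹) (φ-power j) ⟨
      φ ^φ suc j +φ φ⁻¹                                    ∎
      where
      c<N : c < N
      c<N = subst (c <_) (m+n∸m≡n T N) (∸-monoˡ-< (+-monoˡ-< N a<T) T≤a+N)
    above : T ≤ a → sumS m r (F (2 + j)) ≡ φ ^φ suc j
    above T≤a = begin
      sumS m r (F (2 + j))                                 ≡⟨ sum-by-carry c (F j ∸ 1) regroup ⟩
      windowSum (F (1 + j) + F j) (c / N + (F j ∸ 1))      ≡⟨ cong (λ x → windowSum (F (1 + j) + F j) (x + (F j ∸ 1))) (/-one N≤c c<2N) ⟩
      windowSum (F (1 + j) + F j) (suc (F j ∸ 1))          ≡⟨ cong (windowSum (F (1 + j) + F j)) (suc[n∸1]≡n (F-pos 1≤j)) ⟩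
      windowSum (F (1 + j) + F j) (F j)                    ≡⟨ window-exact (F (1 + j)) (F j) ⟩
      ⟨ ℤ.+ F j , ℤ.+ F (1 + j) ⟩                          ≡⟨ φ-power j ⟨
      φ ^φ suc j                                           ∎
      where
      N≤c : N ≤ c
      N≤c = subst (N ≤_) (sym (+-∸-comm N T≤a)) (m≤n+m N (a ∸ T))
      c<2N : c < N + N
      c<2N = ≤-<-trans (m∸n≤m (a + N) T) (+-monoˡ-< N (π<N r))

  -- k even: π(r) + F_k q = (π(r) + F_t) + F_j N, carry 0 or 1.
  even-window : j % 2 ≡ 0 →
      (N ≤ a + T → sumS m r (F (2 + j)) ≡ φ ^φ suc j -φ φ⁻¹)
    × (a + T < N → sumS m r (F (2 + j)) ≡ φ ^φ suc j)
  even-window even = above , below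
    where
    regroup : a + T + F j * N ≡ a + F (2 + j) * q
    regroup = begin
      a + T + F j * N              ≡⟨ +-assoc a T _ ⟩
      a + (T + F j * N)            ≡⟨ cong (a +_) (+-comm T _) ⟩
      a + (F j * N + T)            ≡⟨ cong (λ x → a + (F j * x + T)) N≡Fm ⟩
      a + (F j * F m + T)          ≡⟨ cong (a +_) (vajda-even j t even) ⟨
      a + F (2 + j) * q            ∎
    above : N ≤ a + T → sumS m r (F (2 + j)) ≡ φ ^φ suc j -φ φ⁻¹
    above N≤a+T = begin
      sumS m r (F (2 + j))                                 ≡⟨ sum-by-carry (a + T) (F j) regroup ⟩
      windowSum (F (1 + j) + F j) ((a + T) / N + F j)      ≡⟨ cong (λ x → windowSum (F (1 + j) + F j) (x + F j)) (/-one N≤a+T (+-mono-< (π<N r) T<N)) ⟩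
      windowSum (F (1 + j) + F j) (suc (F j))              ≡⟨ window-more (F (1 + j)) (F j) (F-pos {1 + j} (s≤s z≤n)) ⟩
      ⟨ ℤ.+ F j , ℤ.+ F (1 + j) ⟩ -φ φ⁻¹                   ≡⟨ cong (_-φ φ⁻¹) (φ-power j) ⟨
      φ ^φ suc j -φ φ⁻¹                                    ∎
    below : a + T < N → sumS m r (F (2 + j)) ≡ φ ^φ suc j
    below a+T<N = begin
      sumS m r (F (2 + j))                                 ≡⟨ sum-by-carry (a + T) (F j) regroup ⟩
      windowSum (F (1 + j) + F j) ((a + T) / N + F j)      ≡⟨ cong (λ x → windowSum (F (1 + j) + F j) (x + F j)) (m<n⇒m/n≡0 a+T<N) ⟩
      windowSum (F (1 + j) + F j) (F j)                    ≡⟨ window-exact (F (1 + j)) (F j) ⟩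
      ⟨ ℤ.+ F j , ℤ.+ F (1 + j) ⟩                          ≡⟨ φ-power j ⟨
      φ ^φ suc j                                           ∎

WindowSums : ℕ → ℕ → ℕ → Set
WindowSums m k r =
    (k % 2 ≡ 1 →
      (π m r < F (m ∸ k) → sumS m r (F k) ≡ φ ^φ (k ∸ 1) +φ φ⁻¹)
      × (¬ (π m r < F (m ∸ k)) → sumS m r (F k) ≡ φ ^φ (k ∸ 1)))
    × (k % 2 ≡ 0 →
      (π m r ≥ F m ∸ F (m ∸ k) → sumS m r (F k) ≡ φ ^φ (k ∸ 1) -φ φ⁻¹)
      × (¬ (π m r ≥ F m ∸ F (m ∸ k)) → sumS m r (F k) ≡ φ ^φ (k ∸ 1)))

window-sums : ∀ j t r → 1 ≤ j → WindowSums (2 + j + t) (2 + j) r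
window-sums j t r 1≤j rewrite m+n∸m≡n j t =
    (λ odd → let below , above = odd-window odd in below , λ a≮T → above (≮⇒≥ a≮T))
  , (λ even → let above , below = even-window even in
       (λ ge → above (crosses ge)) , λ nge → below (stays nge))
  where
  open Window j t r 1≤j
  T≤Fm : T ≤ F m
  T≤Fm = subst (T ≤_) N≡Fm (<⇒≤ T<N)
  crosses : F m ∸ T ≤ a → N ≤ a + T
  crosses ge = subst (_≤ a + T) (trans (m∸n+n≡m T≤Fm) (sym N≡Fm)) (+-monoˡ-≤ T ge)
  stays : ¬ (F m ∸ T ≤ a) → a + T < N
  stays nge = subst (a + T <_) (trans (m∸n+n≡m T≤Fm) (sym N≡Fm)) (+-monoˡ-< T (≰⇒> nge))

lemma2 : (m k r : ℕ) → 5 ≤ m → 3 ≤ k → k ≤ m ∸ 1 →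
    (k % 2 ≡ 1 →
      (π m r < F (m ∸ k) → sumS m r (F k) ≡ φ ^φ (k ∸ 1) +φ φ⁻¹)
      × (¬ (π m r < F (m ∸ k)) → sumS m r (F k) ≡ φ ^φ (k ∸ 1)))
    × (k % 2 ≡ 0 →
      (π m r ≥ F m ∸ F (m ∸ k) → sumS m r (F k) ≡ φ ^φ (k ∸ 1) -φ φ⁻¹)
      × (¬ (π m r ≥ F m ∸ F (m ∸ k)) → sumS m r (F k) ≡ φ ^φ (k ∸ 1)))
lemma2 m 1 r _ (s≤s ()) _
lemma2 m 2 r _ (s≤s (s≤s ())) _
lemma2 m (suc (suc (suc i))) r _ _ k≤m-1 =
  subst (λ n → WindowSums n (3 + i) r) (m+[n∸m]≡n k≤m) (window-sums (suc i) (m ∸ (3 + i)) r (s≤s z≤n))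
  where
  k≤m : 3 + i ≤ m
  k≤m = ≤-trans k≤m-1 (m∸n≤m m 1)
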